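{- Let $p$ and $q$ be positive odd integers such that $q \mid p^2+p+1$ and $p \mid q+1$. Then $(p,q)=(1,1)$ or $(p,q)=(1,3)$. -}

module Defs where

module Submission where

-- Write q m = p² + p + 1 and q + 1 = k p. Then m (q + 1) ≡ m + 1 (mod p), so
-- p ∣ m + 1, say m + 1 = j p. Expanding (m + 1)(q + 1) = j k p² in two ways gives
-- the Diophantine equation j k p = p + 1 + j + k. For p ≥ 3 its two sides differ
-- unless j k = 2, and then it forces the even value p = 4. Hence p = 1, and q is
-- an odd divisor of 3.

open import Defs
open import Data.Nat using (ℕ; _+_; _*_; _<_; zero; suc; s≤s; NonZero)
open import Data.Nat.Divisibility using (_∣_; module _∣_; divides; ∣m+n∣m⇒∣n; ∣⇒≤; n∣m*n)
open import Data.Nat.Properties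
  using (m≢1+m+n; *-assoc; *-zeroʳ; *-cancelʳ-≡; +-cancelʳ-≡)
open import Data.Nat.Tactic.RingSolver using (solve-∀)
open import Data.Product using (_×_; _,_)
open import Data.Sum using (_⊎_; inj₁; inj₂)
open import Data.Empty using (⊥-elim)
open import Relation.Nullary using (¬_)
open import Relation.Binary.PropositionalEquality
  using (_≡_; _≢_; ≢-sym; refl; sym; trans; cong; cong₂; subst; module ≡-Reasoning)

exceeds⇒≢ : ∀ {m n x} → m ≡ suc (n + x) → m ≢ n
exceeds⇒≢ {n = n} m≡1+n+x m≡n = m≢1+m+n n (trans (sym m≡n) m≡1+n+x)

∣cofactor+1 : ∀ p q m k → p * p + p + 1 ≡ m * q → q + 1 ≡ k * p → p ∣ 1 + m
∣cofactor+1 p q m k pq≡mq q+1≡kp = ∣m+n∣m⇒∣n p∣sum (divides (p + 1) (expand p))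
  where
  expand : ∀ p → p * p + p ≡ (p + 1) * p
  expand = solve-∀
  regroup : ∀ p m → p * p + p + (1 + m) ≡ p * p + p + 1 + m
  regroup = solve-∀
  distrib : ∀ m q → m * q + m ≡ m * (q + 1)
  distrib = solve-∀
  sum≡ : p * p + p + (1 + m) ≡ m * k * p
  sum≡ = begin
    p * p + p + (1 + m)   ≡⟨ regroup p m ⟩
    p * p + p + 1 + m     ≡⟨ cong (_+ m) pq≡mq ⟩
    m * q + m             ≡⟨ distrib m q ⟩
    m * (q + 1)           ≡⟨ cong (m *_) q+1≡kp ⟩
    m * (k * p)           ≡⟨ *-assoc m k p ⟨
    m * k * p             ∎
    where open ≡-Reasoning
  p∣sum : p ∣ p * p + p + (1 + m)
  p∣sum = subst (p ∣_) (sym sum≡) (n∣m*n (m * k))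

cofactor-equation : ∀ p q m j k .{{_ : NonZero p}} →
  p * p + p + 1 ≡ m * q → q + 1 ≡ k * p → 1 + m ≡ j * p →
  j * k * p ≡ p + 1 + j + k
cofactor-equation p q m j k pq≡mq q+1≡kp 1+m≡jp =
  *-cancelʳ-≡ (j * k * p) (p + 1 + j + k) p (+-cancelʳ-≡ 1 _ _ (begin
    j * k * p * p + 1             ≡⟨ cong (_+ 1) (rearrange j k p) ⟩
    (j * p) * (k * p) + 1         ≡⟨ cong₂ (λ x y → x * y + 1) 1+m≡jp q+1≡kp ⟨
    (1 + m) * (q + 1) + 1         ≡⟨ expand m q ⟩
    m * q + (1 + m) + (q + 1)     ≡⟨ cong₂ _+_ (cong₂ _+_ (sym pq≡mq) 1+m≡jp) q+1≡kp ⟩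
    p * p + p + 1 + j * p + k * p ≡⟨ collect p j k ⟩
    (p + 1 + j + k) * p + 1       ∎))
  where
  open ≡-Reasoning
  rearrange : ∀ j k p → j * k * p * p ≡ (j * p) * (k * p)
  rearrange = solve-∀
  expand : ∀ m q → (1 + m) * (q + 1) + 1 ≡ m * q + (1 + m) + (q + 1)
  expand = solve-∀
  collect : ∀ p j k → p * p + p + 1 + j * p + k * p ≡ (p + 1 + j + k) * p + 1
  collect = solve-∀

j*k*p≢p+1+j+k : ∀ j k c → ¬ 2 ∣ 3 + c → j * k * (3 + c) ≢ 3 + c + 1 + j + k
j*k*p≢p+1+j+k zero k c _ ()
j*k*p≢p+1+j+k (suc j) zero c _ rewrite *-zeroʳ (suc j) = λ ()
j*k*p≢p+1+j+k 1 1 c _ = ≢-sym (exceeds⇒≢ (excess c))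
  where
  excess : ∀ c → 3 + c + 1 + 1 + 1 ≡ suc (1 * 1 * (3 + c) + 2)
  excess = solve-∀
j*k*p≢p+1+j+k 1 2 zero _ ()
j*k*p≢p+1+j+k 1 2 (suc zero) odd _ = odd (divides 2 refl)
j*k*p≢p+1+j+k 1 2 (suc (suc d)) _ = exceeds⇒≢ (excess d)
  where
  excess : ∀ d → 1 * 2 * (5 + d) ≡ suc (5 + d + 1 + 1 + 2 + d)
  excess = solve-∀
j*k*p≢p+1+j+k 2 1 zero _ ()
j*k*p≢p+1+j+k 2 1 (suc zero) odd _ = odd (divides 2 refl)
j*k*p≢p+1+j+k 2 1 (suc (suc d)) _ = exceeds⇒≢ (excess d)
  where
  excess : ∀ d → 2 * 1 * (5 + d) ≡ suc (5 + d + 1 + 2 + 1 + d)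
  excess = solve-∀
j*k*p≢p+1+j+k 1 (suc (suc (suc b))) c _ = exceeds⇒≢ (excess b c)
  where
  excess : ∀ b c → 1 * (3 + b) * (3 + c) ≡ suc (3 + c + 1 + 1 + (3 + b) + (2 * b + 2 * c + b * c))
  excess = solve-∀
j*k*p≢p+1+j+k (suc (suc (suc a))) 1 c _ = exceeds⇒≢ (excess a c)
  where
  excess : ∀ a c → (3 + a) * 1 * (3 + c) ≡ suc (3 + c + 1 + (3 + a) + 1 + (2 * a + 2 * c + a * c))
  excess = solve-∀
j*k*p≢p+1+j+k (suc (suc a)) (suc (suc b)) c _ = exceeds⇒≢ (excess a b c)
  where
  excess : ∀ a b c → (2 + a) * (2 + b) * (3 + c) ≡
    suc (3 + c + 1 + (2 + a) + (2 + b) + (3 + 5 * a + 5 * b + 3 * a * b + 3 * c + 2 * a * c + 2 * b * c + a * b * c))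
  excess = solve-∀

odd-divisor-of-3 : ∀ q → 0 < q → ¬ 2 ∣ q → q ∣ 3 → q ≡ 1 ⊎ q ≡ 3
odd-divisor-of-3 1 _ _ _ = inj₁ refl
odd-divisor-of-3 2 _ odd _ = ⊥-elim (odd (divides 1 refl))
odd-divisor-of-3 3 _ _ _ = inj₂ refl
odd-divisor-of-3 (suc (suc (suc (suc q)))) _ _ q∣3 with ∣⇒≤ q∣3
... | s≤s (s≤s (s≤s ()))

mainTheorem1 : (p q : ℕ) → 0 < p → 0 < q → ¬ (2 ∣ p) → ¬ (2 ∣ q) →
    q ∣ p * p + p + 1 → p ∣ q + 1 →
    (p ≡ 1 × q ≡ 1) ⊎ (p ≡ 1 × q ≡ 3)
mainTheorem1 1 q _ q>0 _ odd-q q∣3 _ with odd-divisor-of-3 q q>0 odd-q q∣3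
... | inj₁ q≡1 = inj₁ (refl , q≡1)
... | inj₂ q≡3 = inj₂ (refl , q≡3)
mainTheorem1 2 _ _ _ odd-p _ _ _ = ⊥-elim (odd-p (divides 1 refl))
mainTheorem1 p@(suc (suc (suc c))) q _ _ odd-p _ (divides m pq≡mq) (divides k q+1≡kp) =
  ⊥-elim (j*k*p≢p+1+j+k j k c odd-p (cofactor-equation p q m j k pq≡mq q+1≡kp 1+m≡jp))
  where
  open _∣_ (∣cofactor+1 p q m k pq≡mq q+1≡kp) renaming (quotient to j; equality to 1+m≡jp)
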